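{- Let $m>1$ and let $C_m$ be the category defined in the context. Let $f=(a,\overline{x},i,j)$ be a morphism of $C_m$ from $(\overline{x},i)$ to $(\overline{y},j)$. For integers $b$ with $0\le b\le a$ and $t$ with $0\le t\le i-j-a$, put $\overline{z_b}=\overline{b}+\overline{x}$, $k_{b,t}=a-b+j+t$, and let $X_{b,t}$ be the factorization $$f=(a-b,\overline{z_b},k_{b,t},j)\circ(b,\overline{x},i,k_{b,t}),\qquad (\overline{x},i)\to(\overline{z_b},k_{b,t})\to(\overline{y},j),$$ regarded as an object of the Lawvere interval $I(f)$. Then for $0\le b,b'\le a$ and $0\le p,t\le i-j-a$, the set $\mathrm{Hom}_{I(f)}(X_{b,t},X_{b',p})$ is non-empty and a singleton if and only if $b\le b'$ and $p\le t$.
   Context: Let $m>1$ be an integer, $\mathbb{Z}_m$ the cyclic group of integers modulo $m$ (residue class of an integer $n$ written $\overline{n}$), $\mathbb{Z}_-$ the set of non-positive integers and $\mathbb{Z}_+$ the set of non-negative integers. The category $C_m$ has object set $\mathbb{Z}_m\times\mathbb{Z}_-$; for objects $(\overline{x},i),(\overline{y},j)$, $\mathrm{Hom}_{C_m}((\overline{x},i),(\overline{y},j))=\{(a,\overline{x},i,j)\mid a\in\mathbb{Z}_+,\ a\le i-j,\ \overline{a}+\overline{x}=\overline{y}\}$; composition is $(b,\overline{y},j,k)\circ(a,\overline{x},i,j)=(a+b,\overline{x},i,k)$ (identities are $(0,\overline{x},i,i)$). For a morphism $f$ of a small category $C$, the Lawvere interval $I(f)$ is the category whose objects are the factorizations $f=u\circ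 v$ in $C$ (pairs $(v,u)$ with $u\circ v=f$), and a morphism from $(v,u)$ to $(v',u')$ is a morphism $h$ of $C$ from the codomain of $v$ to the codomain of $v'$ with $h\circ v=v'$ and $u'\circ h=u$; composition is that of $C$. -}

module Defs where

open import Data.Nat as ℕ using (ℕ; NonZero)
open import Data.Nat.DivMod using (_mod_; _%_; %-distribˡ-+; m%n%n≡m%n)
import Data.Nat.Properties as ℕP
open import Data.Fin using (Fin; toℕ)
open import Data.Fin.Properties using (toℕ-fromℕ<; toℕ-injective)
open import Data.Integer as ℤ using (ℤ; +_; 0ℤ; _-_; -_)
import Data.Integer.Properties as ℤP
open import Data.Integer.Tactic.RingSolver using (solve-∀)
open import Data.Product using (Σ; _×_; _,_)
open import Relation.Binary.PropositionalEquality

-- The category C_m  (m > 1 is imposed in the theorem; here only m ≠ 0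
-- is needed to form residues).

module Cm (m : ℕ) .{{_ : NonZero m}} where

  cl : ℕ → Fin m
  cl n = n mod m

  _⊕_ : Fin m → Fin m → Fin m
  x ⊕ y = (toℕ x ℕ.+ toℕ y) mod m

  toℕ-cl : ∀ n → toℕ (cl n) ≡ n % m
  toℕ-cl n = toℕ-fromℕ< _

  toℕ-⊕ : ∀ x y → toℕ (x ⊕ y) ≡ (toℕ x ℕ.+ toℕ y) % m
  toℕ-⊕ x y = toℕ-fromℕ< _

  record Obj : Set where
    constructor obj
    field
      res    : Fin m
      lvl    : ℤ
      nonpos : lvl ℤ.≤ 0ℤ
  open Obj public

  Tuple : Set
  Tuple = ℕ × Fin m × ℤ × ℤ

  _∘ₜ_ : Tuple → Tuple → Tuple
  (b , _ , _ , k) ∘ₜ (a , x , i , _) = (a ℕ.+ b , x , i , k)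

  record Hom (X Y : Obj) : Set where
    constructor hom
    field
      amt   : ℕ
      bound : + amt ℤ.≤ lvl X - lvl Y
      shift : cl amt ⊕ res X ≡ res Y
  open Hom public

  tuple : ∀ {X Y} → Hom X Y → Tuple
  tuple {X} {Y} h = (amt h , res X , lvl X , lvl Y)

  module Interval {A B : Obj} (f : Hom A B) where

    record IObj : Set where
      constructor fac
      field
        mid  : Obj
        v    : Hom A mid
        u    : Hom mid B
        comp : tuple u ∘ₜ tuple v ≡ tuple f
    open IObj public

    record IHom (P Q : IObj) : Set where
      constructor ihom
      field
        h     : Hom (mid P) (mid Q)
        left  : tuple h ∘ₜ tuple (v P) ≡ tuple (v Q)
        right : tuple (u Q) ∘ₜ tuple h ≡ tuple (u P)
    open IHom public

    -- Hom_{I(f)}(P,Q) is non-empty and a singleton; two morphisms of I(f)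
    -- are equal iff they are equal as morphisms of C_m (equal tuples).
    IsSingletonHom : IObj → IObj → Set
    IsSingletonHom P Q =
      Σ (IHom P Q) λ g → ∀ (g' : IHom P Q) → tuple (h g') ≡ tuple (h g)

    private
      a = amt f
      x = res A
      i = lvl A
      j = lvl B

    zb : ℕ → Fin m
    zb b = cl b ⊕ x

    kbt : ℕ → ℕ → ℤ
    kbt b t = + a - + b ℤ.+ j ℤ.+ + t

    private
      e1 : ∀ a b j i → (a - b ℤ.+ j) ℤ.+ (i - j - a) ≡ (i - b)
      e1 = solve-∀
      e2 : ∀ a b j t i → b ℤ.+ ((i - j - a) - t) ≡ i - (a - b ℤ.+ j ℤ.+ t)
      e2 = solve-∀
      e3 : ∀ a b j t → (a - b) ℤ.+ t ≡ (a - b ℤ.+ j ℤ.+ t) - j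
      e3 = solve-∀

      k≤i : ∀ b t → + t ℤ.≤ i - j - + a → kbt b t ℤ.≤ i
      k≤i b t tle = ℤP.≤-trans
        (subst (kbt b t ℤ.≤_) (e1 (+ a) (+ b) j i) (ℤP.+-monoʳ-≤ (+ a - + b ℤ.+ j) tle))
        (subst (i - + b ℤ.≤_) (ℤP.+-identityʳ i)
          (ℤP.+-monoʳ-≤ i (ℤP.neg-mono-≤ (ℤ.+≤+ ℕ.z≤n))))

      0≤D-t : ∀ t → + t ℤ.≤ i - j - + a → 0ℤ ℤ.≤ (i - j - + a) - + t
      0≤D-t t tle = subst (ℤ._≤ (i - j - + a) - + t) (ℤP.+-inverseʳ (+ t))
        (ℤP.+-monoˡ-≤ (- + t) tle)

      a-b : ∀ b → b ℕ.≤ a → + (a ℕ.∸ b) ≡ + a - + b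
      a-b b ble = trans (sym (ℤP.⊖-≥ ble)) (sym (ℤP.m-n≡m⊖n a b))

      clmod : ∀ p q → (p ℕ.+ q % m) % m ≡ (p ℕ.+ q) % m
      clmod p q = trans (%-distribˡ-+ p (q % m) m)
        (trans (cong (λ r → (p % m ℕ.+ r) % m) (m%n%n≡m%n q m))
               (sym (%-distribˡ-+ p q m)))

      clmodˡ : ∀ p q → (p % m ℕ.+ q) % m ≡ (p ℕ.+ q) % m
      clmodˡ p q = trans (cong (_% m) (ℕP.+-comm (p % m) q))
        (trans (clmod q p) (cong (_% m) (ℕP.+-comm q p)))

    Zbt : (b t : ℕ) → + t ℤ.≤ i - j - + a → Obj
    Zbt b t tle = obj (zb b) (kbt b t) (ℤP.≤-trans (k≤i b t tle) (nonpos A))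

    vbt : (b t : ℕ) (tle : + t ℤ.≤ i - j - + a) → Hom A (Zbt b t tle)
    vbt b t tle = hom b
      (subst (+ b ℤ.≤_) (e2 (+ a) (+ b) j (+ t) i)
        (subst (ℤ._≤ + b ℤ.+ ((i - j - + a) - + t)) (ℤP.+-identityʳ (+ b))
          (ℤP.+-monoʳ-≤ (+ b) (0≤D-t t tle))))
      refl

    ubt : (b t : ℕ) → b ℕ.≤ a → (tle : + t ℤ.≤ i - j - + a) → Hom (Zbt b t tle) B
    ubt b t ble tle = hom (a ℕ.∸ b)
      (subst (ℤ._≤ kbt b t - j) (sym (a-b b ble))
        (subst (+ a - + b ℤ.≤_) (e3 (+ a) (+ b) j (+ t))
          (subst (ℤ._≤ (+ a - + b) ℤ.+ + t) (ℤP.+-identityʳ (+ a - + b))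
            (ℤP.+-monoʳ-≤ (+ a - + b) (ℤ.+≤+ ℕ.z≤n)))))
      (trans (toℕ-injective eq) (shift f))
      where
        eq : toℕ (cl (a ℕ.∸ b) ⊕ zb b) ≡ toℕ (cl a ⊕ x)
        eq = begin
          toℕ (cl (a ℕ.∸ b) ⊕ zb b)
            ≡⟨ toℕ-⊕ (cl (a ℕ.∸ b)) (zb b) ⟩
          (toℕ (cl (a ℕ.∸ b)) ℕ.+ toℕ (zb b)) % m
            ≡⟨ cong₂ (λ p q → (p ℕ.+ q) % m) (toℕ-cl (a ℕ.∸ b)) (toℕ-⊕ (cl b) x) ⟩
          ((a ℕ.∸ b) % m ℕ.+ (toℕ (cl b) ℕ.+ toℕ x) % m) % m
            ≡⟨ clmodˡ (a ℕ.∸ b) _ ⟩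
          ((a ℕ.∸ b) ℕ.+ (toℕ (cl b) ℕ.+ toℕ x) % m) % m
            ≡⟨ clmod (a ℕ.∸ b) _ ⟩
          ((a ℕ.∸ b) ℕ.+ (toℕ (cl b) ℕ.+ toℕ x)) % m
            ≡⟨ cong (λ p → ((a ℕ.∸ b) ℕ.+ (p ℕ.+ toℕ x)) % m) (toℕ-cl b) ⟩
          ((a ℕ.∸ b) ℕ.+ (b % m ℕ.+ toℕ x)) % m
            ≡⟨ cong (_% m) (ℕP.+-comm (a ℕ.∸ b) _) ⟩
          ((b % m ℕ.+ toℕ x) ℕ.+ (a ℕ.∸ b)) % m
            ≡⟨ cong (_% m) (ℕP.+-assoc (b % m) (toℕ x) (a ℕ.∸ b)) ⟩
          (b % m ℕ.+ (toℕ x ℕ.+ (a ℕ.∸ b))) % m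
            ≡⟨ clmodˡ b _ ⟩
          (b ℕ.+ (toℕ x ℕ.+ (a ℕ.∸ b))) % m
            ≡⟨ cong (λ p → (b ℕ.+ p) % m) (ℕP.+-comm (toℕ x) (a ℕ.∸ b)) ⟩
          (b ℕ.+ ((a ℕ.∸ b) ℕ.+ toℕ x)) % m
            ≡⟨ cong (_% m) (sym (ℕP.+-assoc b (a ℕ.∸ b) (toℕ x))) ⟩
          ((b ℕ.+ (a ℕ.∸ b)) ℕ.+ toℕ x) % m
            ≡⟨ cong (λ p → (p ℕ.+ toℕ x) % m) (ℕP.m+[n∸m]≡n ble) ⟩
          (a ℕ.+ toℕ x) % m
            ≡⟨ sym (clmodˡ a _) ⟩
          (a % m ℕ.+ toℕ x) % m
            ≡⟨ cong (λ p → (p ℕ.+ toℕ x) % m) (sym (toℕ-cl a)) ⟩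
          (toℕ (cl a) ℕ.+ toℕ x) % m
            ≡⟨ sym (toℕ-⊕ (cl a) x) ⟩
          toℕ (cl a ⊕ x) ∎
          where open ≡-Reasoning

    Xbt : (b t : ℕ) → b ℕ.≤ a → + t ℤ.≤ i - j - + a → IObj
    Xbt b t ble tle = fac (Zbt b t tle) (vbt b t tle) (ubt b t ble tle)
      (cong (λ n → (n , x , i , j)) (ℕP.m+[n∸m]≡n ble))

-- A morphism X_{b,t} → X_{b',p} of I(f) is a morphism
-- (c, z̄_b, k_{b,t}, k_{b',p}) of C_m.  The triangle condition h ∘ v = v'
-- compares first components and forces b + c = b'; so c is determined,
-- and in fact every hom-set of I(f) has at most one element.  It remains
-- to decide when c = b' - b is admissible: the level constraint
-- c ≤ k_{b,t} - k_{b',p} = (b' - b) + (t - p) holds iff p ≤ t, and the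
-- residue and second triangle conditions hold automatically.
module Submission where

open import Defs
open import Data.Nat as ℕ using (ℕ; NonZero; _<_; _≤_)
open import Data.Nat.DivMod using (_%_; %-distribˡ-+; m%n%n≡m%n)
import Data.Nat.Properties as ℕP
open import Data.Integer as ℤ using (+_; _-_)
import Data.Integer.Properties as ℤP
open import Data.Integer.Tactic.RingSolver using (solve-∀)
open import Data.Fin using (toℕ)
open import Data.Fin.Properties using (toℕ-injective)
open import Data.Product using (_×_; _,_; proj₁)
open import Function.Bundles using (_⇔_; mk⇔; Equivalence)
open import Function.Construct.Composition using (_⇔-∘_)
open import Relation.Binary.PropositionalEquality

∸-telescope : ∀ {a b b'} → b ≤ b' → b' ≤ a → (b' ℕ.∸ b) ℕ.+ (a ℕ.∸ b') ≡ a ℕ.∸ b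
∸-telescope {a} {b} {b'} b≤b' b'≤a = begin
  (b' ℕ.∸ b) ℕ.+ (a ℕ.∸ b')   ≡⟨ ℕP.+-comm (b' ℕ.∸ b) (a ℕ.∸ b') ⟩
  (a ℕ.∸ b') ℕ.+ (b' ℕ.∸ b)   ≡⟨ ℕP.+-∸-assoc (a ℕ.∸ b') b≤b' ⟨
  ((a ℕ.∸ b') ℕ.+ b') ℕ.∸ b   ≡⟨ cong (ℕ._∸ b) (ℕP.m∸n+n≡m b'≤a) ⟩
  a ℕ.∸ b                     ∎
  where open ≡-Reasoning

+≤+-+⇔+≤ : ∀ c n q → (+ c ℤ.≤ + n - + q) ⇔ (c ℕ.+ q ≤ n)
+≤+-+⇔+≤ c n q = mk⇔ to from
  where
    i-j+j≡i : ∀ i j → i - j ℤ.+ j ≡ i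
    i-j+j≡i = solve-∀
    i+j-j≡i : ∀ i j → i ℤ.+ j - j ≡ i
    i+j-j≡i = solve-∀

    to : + c ℤ.≤ + n - + q → c ℕ.+ q ≤ n
    to le = ℤP.drop‿+≤+ (subst₂ ℤ._≤_ (sym (ℤP.pos-+ c q)) (i-j+j≡i (+ n) (+ q))
                          (ℤP.+-monoˡ-≤ (+ q) le))

    from : c ℕ.+ q ≤ n → + c ℤ.≤ + n - + q
    from le = subst (ℤ._≤ + n - + q)
                (trans (cong (_- + q) (ℤP.pos-+ c q)) (i+j-j≡i (+ c) (+ q)))
                (ℤP.+-monoˡ-≤ (ℤ.- + q) (ℤ.+≤+ le))

module _ (m : ℕ) .{{_ : NonZero m}} where
  open Cm m

  %-absorbʳ : ∀ p q → (p ℕ.+ q % m) % m ≡ (p ℕ.+ q) % m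
  %-absorbʳ p q = begin
    (p ℕ.+ q % m) % m           ≡⟨ %-distribˡ-+ p (q % m) m ⟩
    (p % m ℕ.+ q % m % m) % m   ≡⟨ cong (λ r → (p % m ℕ.+ r) % m) (m%n%n≡m%n q m) ⟩
    (p % m ℕ.+ q % m) % m       ≡⟨ %-distribˡ-+ p q m ⟨
    (p ℕ.+ q) % m               ∎
    where open ≡-Reasoning

  %-absorbˡ : ∀ p q → (p % m ℕ.+ q) % m ≡ (p ℕ.+ q) % m
  %-absorbˡ p q = begin
    (p % m ℕ.+ q) % m   ≡⟨ cong (_% m) (ℕP.+-comm (p % m) q) ⟩
    (q ℕ.+ p % m) % m   ≡⟨ %-absorbʳ q p ⟩
    (q ℕ.+ p) % m       ≡⟨ cong (_% m) (ℕP.+-comm q p) ⟩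
    (p ℕ.+ q) % m       ∎
    where open ≡-Reasoning

  cl-+ : ∀ c b → cl (c ℕ.+ b) ≡ cl c ⊕ cl b
  cl-+ c b = toℕ-injective (begin
    toℕ (cl (c ℕ.+ b))                  ≡⟨ toℕ-cl (c ℕ.+ b) ⟩
    (c ℕ.+ b) % m                       ≡⟨ %-distribˡ-+ c b m ⟩
    (c % m ℕ.+ b % m) % m               ≡⟨ cong₂ (λ r s → (r ℕ.+ s) % m) (toℕ-cl c) (toℕ-cl b) ⟨
    (toℕ (cl c) ℕ.+ toℕ (cl b)) % m     ≡⟨ toℕ-⊕ (cl c) (cl b) ⟨
    toℕ (cl c ⊕ cl b)                   ∎)
    where open ≡-Reasoning

  ⊕-assoc : ∀ x y z → (x ⊕ y) ⊕ z ≡ x ⊕ (y ⊕ z)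
  ⊕-assoc x y z = toℕ-injective (begin
    toℕ ((x ⊕ y) ⊕ z)                   ≡⟨ toℕ-⊕ (x ⊕ y) z ⟩
    (toℕ (x ⊕ y) ℕ.+ Z) % m             ≡⟨ cong (λ r → (r ℕ.+ Z) % m) (toℕ-⊕ x y) ⟩
    ((X ℕ.+ Y) % m ℕ.+ Z) % m           ≡⟨ %-absorbˡ (X ℕ.+ Y) Z ⟩
    ((X ℕ.+ Y) ℕ.+ Z) % m               ≡⟨ cong (_% m) (ℕP.+-assoc X Y Z) ⟩
    (X ℕ.+ (Y ℕ.+ Z)) % m               ≡⟨ %-absorbʳ X (Y ℕ.+ Z) ⟨
    (X ℕ.+ (Y ℕ.+ Z) % m) % m           ≡⟨ cong (λ r → (X ℕ.+ r) % m) (toℕ-⊕ y z) ⟨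
    (X ℕ.+ toℕ (y ⊕ z)) % m             ≡⟨ toℕ-⊕ x (y ⊕ z) ⟨
    toℕ (x ⊕ (y ⊕ z))                   ∎)
    where
      open ≡-Reasoning
      X = toℕ x
      Y = toℕ y
      Z = toℕ z

  module _ {A B : Obj} (f : Hom A B) where
    open Interval f

    left-amt : ∀ {P Q} (g : IHom P Q) → amt (v P) ℕ.+ amt (h g) ≡ amt (v Q)
    left-amt g = cong proj₁ (left g)

    IHom-unique : ∀ {P Q} (g g' : IHom P Q) → tuple (h g) ≡ tuple (h g')
    IHom-unique {P} g g' = cong (λ c → (c , res (mid P) , lvl (mid P) , _))
      (ℕP.+-cancelˡ-≡ (amt (v P)) (amt (h g)) (amt (h g'))
        (trans (left-amt g) (sym (left-amt g'))))

    singleton⇔inhabited : ∀ {P Q} → IsSingletonHom P Q ⇔ IHom P Q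
    singleton⇔inhabited = mk⇔ proj₁ (λ g → g , λ g' → IHom-unique g' g)

    kbt-gap : ∀ b b' t p → kbt b t - kbt b' p ≡ + (b' ℕ.+ t) - + (b ℕ.+ p)
    kbt-gap b b' t p = begin
      kbt b t - kbt b' p                         ≡⟨ gap (+ amt f) (+ b) (+ b') (lvl B) (+ t) (+ p) ⟩
      (+ b' ℤ.+ + t) - (+ b ℤ.+ + p)             ≡⟨ cong₂ _-_ (ℤP.pos-+ b' t) (ℤP.pos-+ b p) ⟨
      + (b' ℕ.+ t) - + (b ℕ.+ p)                 ∎
      where
        open ≡-Reasoning
        gap : ∀ a b b' j t p → (a - b ℤ.+ j ℤ.+ t) - (a - b' ℤ.+ j ℤ.+ p) ≡ (b' ℤ.+ t) - (b ℤ.+ p)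
        gap = solve-∀

    gap-bound⇔ : ∀ {b b' c} t p → b ℕ.+ c ≡ b' → (+ c ℤ.≤ kbt b t - kbt b' p) ⇔ (p ≤ t)
    gap-bound⇔ {b} {b'} {c} t p b+c≡b' = mk⇔
      (λ le → ℕP.+-cancelˡ-≤ b' p t (subst (_≤ b' ℕ.+ t) c+[b+p]≡b'+p
                 (Equivalence.to (+≤+-+⇔+≤ c _ _) (subst (+ c ℤ.≤_) (kbt-gap b b' t p) le))))
      (λ p≤t → subst (+ c ℤ.≤_) (sym (kbt-gap b b' t p))
                 (Equivalence.from (+≤+-+⇔+≤ c _ _)
                   (subst (_≤ b' ℕ.+ t) (sym c+[b+p]≡b'+p) (ℕP.+-monoʳ-≤ b' p≤t))))
      where
        c+[b+p]≡b'+p : c ℕ.+ (b ℕ.+ p) ≡ b' ℕ.+ p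
        c+[b+p]≡b'+p = begin
          c ℕ.+ (b ℕ.+ p)   ≡⟨ ℕP.+-assoc c b p ⟨
          (c ℕ.+ b) ℕ.+ p   ≡⟨ cong (ℕ._+ p) (trans (ℕP.+-comm c b) b+c≡b+c) ⟩
          b' ℕ.+ p          ∎
          where
            open ≡-Reasoning
            b+c≡b+c = b+c≡b'

    X-hom⇔ : ∀ b b' p t (hb : b ≤ amt f) (hb' : b' ≤ amt f)
               (hp : + p ℤ.≤ lvl A - lvl B - + amt f) (ht : + t ℤ.≤ lvl A - lvl B - + amt f) →
             IHom (Xbt b t hb ht) (Xbt b' p hb' hp) ⇔ (b ≤ b' × p ≤ t)
    X-hom⇔ b b' p t hb hb' hp ht = mk⇔ to from
      where
        to : IHom (Xbt b t hb ht) (Xbt b' p hb' hp) → b ≤ b' × p ≤ t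
        to g = subst (b ≤_) (left-amt g) (ℕP.m≤m+n b (amt (h g)))
             , Equivalence.to (gap-bound⇔ t p (left-amt g)) (bound (h g))

        from : b ≤ b' × p ≤ t → IHom (Xbt b t hb ht) (Xbt b' p hb' hp)
        from (b≤b' , p≤t) = ihom step left-eq right-eq
          where
            c = b' ℕ.∸ b
            b+c≡b' : b ℕ.+ c ≡ b'
            b+c≡b' = ℕP.m+[n∸m]≡n b≤b'

            shift-eq : cl c ⊕ zb b ≡ zb b'
            shift-eq = begin
              cl c ⊕ (cl b ⊕ res A)   ≡⟨ ⊕-assoc (cl c) (cl b) (res A) ⟨
              (cl c ⊕ cl b) ⊕ res A   ≡⟨ cong (_⊕ res A) (cl-+ c b) ⟨
              cl (c ℕ.+ b) ⊕ res A    ≡⟨ cong (λ n → cl n ⊕ res A) (ℕP.m∸n+n≡m b≤b') ⟩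
              cl b' ⊕ res A           ∎
              where open ≡-Reasoning

            step : Hom (mid (Xbt b t hb ht)) (mid (Xbt b' p hb' hp))
            step = hom c (Equivalence.from (gap-bound⇔ t p b+c≡b') p≤t) shift-eq

            left-eq : tuple step ∘ₜ tuple (v (Xbt b t hb ht)) ≡ tuple (v (Xbt b' p hb' hp))
            left-eq = cong (λ n → (n , res A , lvl A , kbt b' p)) b+c≡b'

            right-eq : tuple (u (Xbt b' p hb' hp)) ∘ₜ tuple step ≡ tuple (u (Xbt b t hb ht))
            right-eq = cong (λ n → (n , zb b , kbt b t , lvl B)) (∸-telescope b≤b' hb')

proposition3p3 :
    (m : ℕ) .{{_ : NonZero m}} → 1 < m →
    {A B : Cm.Obj m} (f : Cm.Hom m A B) →
    let open Cm m in
    let open Interval f in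
    (b b' p t : ℕ) →
    (hb : b ≤ amt f) (hb' : b' ≤ amt f) →
    (hp : + p ℤ.≤ lvl A - lvl B - + amt f) (ht : + t ℤ.≤ lvl A - lvl B - + amt f) →
    IsSingletonHom (Xbt b t hb ht) (Xbt b' p hb' hp) ⇔ (b ≤ b' × p ≤ t)
proposition3p3 m _ f b b' p t hb hb' hp ht =
  X-hom⇔ m f b b' p t hb hb' hp ht ⇔-∘ singleton⇔inhabited m f
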